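{- For $n\ge 2$ and $2n\le k\le 3n-1$, \[\#\Big\{(\mathbf{d},\mathbf{r})\in\operatorname{Arith}(\mathcal{C}_n) : \sum_{j=1}^n d_j=k\Big\}=\binom{k-n-1}{k-2n},\] which is the number of multisubsets of $\{1,\dots,n\}$ of size $k-2n$.
   Context: For $n\ge 3$, $\mathcal{C}_n$ is the cycle graph with vertices $1,\dots,n$ and edges $\{i,i+1\}$ (indices mod $n$); $\mathcal{C}_2$ is two vertices joined by two parallel edges (adjacency matrix $\begin{pmatrix}0&2\\2&0\end{pmatrix}$). $\operatorname{Arith}(\mathcal{C}_n)$ is the set of arithmetical structures: pairs $(\mathbf{d},\mathbf{r})$ of positive integer vectors in $\mathbb{Z}^n$ with $\mathbf{r}$ primitive (gcd of entries $1$) and $(\operatorname{diag}(\mathbf{d})-A)\mathbf{r}=\mathbf{0}$, $A$ the adjacency matrix. -}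

module Defs where

open import Data.Nat using (ℕ; zero; suc; _+_; _*_; _<_; _≤_; s≤s)
open import Data.Nat.Properties using (_<?_)
open import Data.Nat.GCD using (gcd)
open import Data.Fin using (Fin; toℕ; fromℕ<) renaming (zero to fzero)
import Data.Fin as F
open import Data.Vec using (Vec; lookup; tabulate; sum; toList)
open import Data.Vec.Relation.Unary.All using (All)
open import Data.List using (List; length; foldr)
open import Data.List.Relation.Unary.Unique.Propositional using (Unique)
open import Data.List.Membership.Propositional using (_∈_)
open import Data.Product using (_×_; _,_; ∃-syntax)
open import Relation.Nullary using (Dec; yes; no)
open import Relation.Nullary.Decidable using (⌊_⌋)
open import Relation.Binary.PropositionalEquality using (_≡_)
open import Function.Bundles using (_⇔_)
open import Data.Bool using (Bool; true; false; _∧_)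

next : ∀ {n} → Fin n → Fin n
next {suc m} i with suc (toℕ i) <? suc m
... | yes p = fromℕ< p
... | no _  = fzero

[_] : Bool → ℕ
[ true ]  = 1
[ false ] = 0

-- Adjacency matrix of the cycle graph C_n: the edges are {i, i+1 mod n}
-- for i = 0..n-1 (one edge per i), and A a b counts the edges joining a and b.
-- For n = 2 this gives the matrix [[0,2],[2,0]] (two parallel edges).
cycleAdj : (n : ℕ) → Fin n → Fin n → ℕ
cycleAdj n a b = sum (tabulate {n = n} λ i →
  [ ⌊ i F.≟ a ⌋ ∧ ⌊ next i F.≟ b ⌋ ] + [ ⌊ i F.≟ b ⌋ ∧ ⌊ next i F.≟ a ⌋ ])

gcdVec : ∀ {n} → Vec ℕ n → ℕ
gcdVec r = foldr gcd 0 (toList r)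

-- (d, r) ∈ Arith(C_n): d, r positive, r primitive, (diag(d) − A) r = 0,
-- the last written entrywise as d_i r_i = Σ_j A_ij r_j (all quantities in ℕ).
IsArith : (n : ℕ) → Vec ℕ n → Vec ℕ n → Set
IsArith n d r =
  All (1 ≤_) d × All (1 ≤_) r × gcdVec r ≡ 1 ×
  (∀ (i : Fin n) → lookup d i * lookup r i ≡ sum (tabulate λ j → cycleAdj n i j * lookup r j))

HasCard : {n : ℕ} → (Vec ℕ n → Vec ℕ n → Set) → ℕ → Set
HasCard {n} P c = ∃[ L ] (Unique {A = Vec ℕ n × Vec ℕ n} L ×
  (∀ d r → ((d , r) ∈ L) ⇔ P d r) × length L ≡ c)

-- For a positive r on the cycle, (d , r) is arithmetical iff every r i
-- divides r (i - 1) + r (i + 1), and then d is determined by r.  Encode r by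
-- c i = ⌈ r (i + 1) / r i ⌉ - 1 = ⌊ (r (i + 1) - 1) / r i ⌋.  If c has a vertex v with
-- c (v - 1) ≥ 1 and c v = 0, then r (v - 1) < r v ≥ r (v + 1), so divisibility forces
-- r v = r (v - 1) + r (v + 1): r is a subdivision of an arithmetical vector on n - 1
-- vertices, subdividing adds 3 to Σ d and 1 to Σ c, and the smaller code is recovered
-- from c.  Otherwise c vanishes, r is constant, and r = 1 if r is primitive.  By
-- induction, r ↦ c is a bijection from primitive arithmetical vectors onto vectors
-- c with Σ c < n, and Σ d = 2 n + Σ c.  So the structures with Σ d = 2 n + j are
-- counted by the weak compositions of j into n parts.
module Submission where

open import Data.Bool using (true; false; _∧_)
open import Data.Empty using (⊥-elim)
open import Data.Fin as F using (Fin; toℕ; fromℕ; fromℕ<; inject₁) renaming (zero to fz; suc to fs)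
open import Data.Fin.Permutation using (Permutation′; permutation; flip)
open import Data.Fin.Properties
  using (toℕ-injective; toℕ-fromℕ<; fromℕ<-toℕ; toℕ-inject₁; toℕ-fromℕ; toℕ<n; fromℕ≢inject₁; any?)
open import Data.List using (List; []; _∷_; map; _++_; length)
open import Data.List.Membership.Propositional using (_∈_)
open import Data.List.Membership.Propositional.Properties using (∈-map⁺; ∈-map⁻; ∈-++⁺ˡ; ∈-++⁺ʳ; ∈-++⁻)
open import Data.List.Properties using (length-map; length-++; map-∘; map-id-local)
import Data.List.Relation.Unary.All as ListAll
open import Data.List.Relation.Unary.All using ([])
open import Data.List.Relation.Unary.Any using (here)
open import Data.List.Relation.Unary.Unique.Propositional using (Unique; []; _∷_)
import Data.List.Relation.Unary.Unique.Propositional.Properties as Unique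
open import Data.Nat using (ℕ; zero; suc; _+_; _*_; _∸_; _≤_; _<_; z≤n; s≤s; _≟_; _≤?_)
open import Data.Nat.Combinatorics using (_C_; nCn≡1; nCk+nC[k+1]≡[n+1]C[k+1])
open import Data.Nat.Divisibility
  using (_∣_; divides; ∣-refl; ∣-trans; ∣m∣n⇒∣m+n; ∣m+n∣m⇒∣n; n∣m*n; ∣1⇒≡1; 1∣_; _∣0)
open import Data.Nat.DivMod using (_/_; +-distrib-/-∣ʳ; m*n/n≡m; m/n*n≡m; n/n≡1; m<n⇒m/n≡0; m/n≡0⇒m<n)
open import Data.Nat.GCD using (gcd[m,n]∣m; gcd[m,n]∣n; gcd-greatest)
open import Data.Nat.Properties
open import Algebra.Properties.Semiring.Sum +-*-semiring
  using (sum-permute; sum-cong-≗; ∑-distrib-+; ∑-comm; *-distribˡ-sum; *-distribʳ-sum)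
  renaming (sum to ∑)
open import Data.Nat.Tactic.RingSolver using (solve-∀)
open import Data.Product using (_×_; _,_; ∃; ∃-syntax)
open import Data.Sum using (inj₁; inj₂)
open import Data.Vec using (Vec; []; _∷_; sum; tabulate; lookup)
open import Data.Vec.Functional using (Vector)
open import Data.Vec.Properties using (tabulate∘lookup; lookup∘tabulate; tabulate-cong; ∷-injectiveʳ)
import Data.Vec.Relation.Unary.All.Properties as VecAll
open import Function using (_∘_)
open import Function.Bundles using (_⇔_; mk⇔; module Equivalence)
open import Relation.Binary.PropositionalEquality hiding ([_])
open import Relation.Nullary using (Dec; yes; no; ¬_)
open import Relation.Nullary.Decidable using (⌊_⌋; ⌊⌋-map′; _×-dec_)

open import Defs

private variable m : ℕ

prev : Fin (suc m) → Fin (suc m)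
prev {m} fz = fromℕ m
prev (fs i) = inject₁ i

next-inject₁ : (i : Fin m) → next (inject₁ i) ≡ fs i
next-inject₁ {m} i with suc (toℕ (inject₁ i)) <? suc m
... | yes p = toℕ-injective (trans (toℕ-fromℕ< p) (cong suc (toℕ-inject₁ i)))
... | no ¬p = ⊥-elim (¬p (s≤s (subst (_< m) (sym (toℕ-inject₁ i)) (toℕ<n i))))

next-fromℕ : ∀ m → next (fromℕ m) ≡ fz
next-fromℕ m with suc (toℕ (fromℕ m)) <? suc m
... | yes p = ⊥-elim (<-irrefl refl (subst (λ x → suc x < suc m) (toℕ-fromℕ m) p))
... | no _  = refl

data InitOrLast (m : ℕ) : Fin (suc m) → Set where
  init : (j : Fin m) → InitOrLast m (inject₁ j)
  last : InitOrLast m (fromℕ m)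

initOrLast : (i : Fin (suc m)) → InitOrLast m i
initOrLast {zero}  fz     = last
initOrLast {suc m} fz     = init fz
initOrLast {suc m} (fs i) with initOrLast i
... | init j = init (fs j)
... | last   = last

next-prev : (i : Fin (suc m)) → next (prev i) ≡ i
next-prev {m} fz = next-fromℕ m
next-prev (fs i) = next-inject₁ i

prev-next : (i : Fin (suc m)) → prev (next i) ≡ i
prev-next {m} i with initOrLast i
... | init j rewrite next-inject₁ j = refl
... | last   rewrite next-fromℕ m   = refl

next^ : ℕ → Fin (suc m) → Fin (suc m)
next^ zero    i = i
next^ (suc t) i = next (next^ t i)

prev^ : ℕ → Fin (suc m) → Fin (suc m)
prev^ zero    i = i
prev^ (suc t) i = prev^ t (prev i)

Shift-equivariant : (Fin (suc m) → Fin (suc m)) → Set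
Shift-equivariant σ = ∀ i → σ (next i) ≡ next (σ i)

equivariant-prev : ∀ {σ : Fin (suc m) → Fin (suc m)} → Shift-equivariant σ →
                   ∀ i → σ (prev i) ≡ prev (σ i)
equivariant-prev {σ = σ} eq i = begin
  σ (prev i)               ≡⟨ prev-next (σ (prev i)) ⟨
  prev (next (σ (prev i))) ≡⟨ cong prev (eq (prev i)) ⟨
  prev (σ (next (prev i))) ≡⟨ cong (prev ∘ σ) (next-prev i) ⟩
  prev (σ i)               ∎
  where open ≡-Reasoning

next^-equivariant : ∀ t → Shift-equivariant {m} (next^ t)
next^-equivariant zero    i = refl
next^-equivariant (suc t) i = cong next (next^-equivariant t i)

prev^-equivariant : ∀ t → Shift-equivariant {m} (prev^ t)
prev^-equivariant zero    i = refl
prev^-equivariant (suc t) i = begin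
  prev^ t (prev (next i))  ≡⟨ cong (prev^ t) (trans (prev-next i) (sym (next-prev i))) ⟩
  prev^ t (next (prev i))  ≡⟨ prev^-equivariant t (prev i) ⟩
  next (prev^ t (prev i))  ∎
  where open ≡-Reasoning

prev^-next^ : ∀ t (i : Fin (suc m)) → prev^ t (next^ t i) ≡ i
prev^-next^ zero    i = refl
prev^-next^ (suc t) i = trans (cong (prev^ t) (prev-next (next^ t i))) (prev^-next^ t i)

next^-prev^ : ∀ t (i : Fin (suc m)) → next^ t (prev^ t i) ≡ i
next^-prev^ zero    i = refl
next^-prev^ (suc t) i = trans (cong next (next^-prev^ t (prev i))) (next-prev i)

next^-fromℕ< : ∀ t (t<n : t < suc m) → next^ t fz ≡ fromℕ< t<n
next^-fromℕ< zero    _   = refl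
next^-fromℕ< {m} (suc t) t<n
  rewrite next^-fromℕ< t (<-trans (n<1+n t) t<n)
  with suc (toℕ (fromℕ< (<-trans (n<1+n t) t<n))) <? suc m
... | yes p = toℕ-injective (trans (toℕ-fromℕ< p)
                (trans (cong suc (toℕ-fromℕ< _)) (sym (toℕ-fromℕ< t<n))))
... | no ¬p = ⊥-elim (¬p (subst (λ x → suc x < suc m) (sym (toℕ-fromℕ< _)) t<n))

next^-toℕ : (v : Fin (suc m)) → next^ (toℕ v) fz ≡ v
next^-toℕ v = trans (next^-fromℕ< (toℕ v) (toℕ<n v)) (fromℕ<-toℕ v (toℕ<n v))

rotation : ℕ → Permutation′ (suc m)
rotation t = permutation (next^ t) (prev^ t) (next^-prev^ t) (prev^-next^ t)

∑-next^ : ∀ t (f : Vector ℕ (suc m)) → ∑ f ≡ ∑ (f ∘ next^ t)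
∑-next^ t f = sum-permute f (rotation t)

∑-prev^ : ∀ t (f : Vector ℕ (suc m)) → ∑ f ≡ ∑ (f ∘ prev^ t)
∑-prev^ t f = sum-permute f (flip (rotation t))

sum-tabulate : ∀ {n} (f : Vector ℕ n) → sum (tabulate f) ≡ ∑ f
sum-tabulate {zero}  f = refl
sum-tabulate {suc n} f = cong (f fz +_) (sum-tabulate (f ∘ fs))

sum-lookup : ∀ {n} (xs : Vec ℕ n) → sum xs ≡ ∑ (lookup xs)
sum-lookup xs = trans (cong sum (sym (tabulate∘lookup xs))) (sum-tabulate (lookup xs))

∑-const : ∀ n a → ∑ {n} (λ _ → a) ≡ n * a
∑-const zero    a = refl
∑-const (suc n) a = cong (a +_) (∑-const n a)

∑-mono-≤ : ∀ {n} {f g : Vector ℕ n} → (∀ i → f i ≤ g i) → ∑ f ≤ ∑ g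
∑-mono-≤ {zero}  f≤g = z≤n
∑-mono-≤ {suc n} f≤g = +-mono-≤ (f≤g fz) (∑-mono-≤ (f≤g ∘ fs))

∑-mono-≡⇒≗ : ∀ {n} {f g : Vector ℕ n} → (∀ i → f i ≤ g i) → ∑ f ≡ ∑ g → ∀ i → f i ≡ g i
∑-mono-≡⇒≗ {suc n} {f} {g} f≤g ∑f≡∑g i = go i
  where
  ∑f≤∑g : ∑ (f ∘ fs) ≤ ∑ (g ∘ fs)
  ∑f≤∑g = ∑-mono-≤ (f≤g ∘ fs)
  head≡ : f fz ≡ g fz
  head≡ = ≤-antisym (f≤g fz) (+-cancelʳ-≤ (∑ (f ∘ fs)) (g fz) (f fz)
            (≤-trans (+-monoʳ-≤ (g fz) ∑f≤∑g) (≤-reflexive (sym ∑f≡∑g))))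
  go : ∀ i → f i ≡ g i
  go fz     = head≡
  go (fs i) = ∑-mono-≡⇒≗ (f≤g ∘ fs) (+-cancelˡ-≡ (f fz) _ _ (trans ∑f≡∑g (cong (_+ _) (sym head≡)))) i

shift-invariant⇒constant : (f : Vector ℕ (suc m)) → (∀ i → f (next i) ≡ f i) → ∀ i → f i ≡ f fz
shift-invariant⇒constant f inv i = trans (cong f (sym (next^-toℕ i))) (along (toℕ i))
  where
  along : ∀ t → f (next^ t fz) ≡ f fz
  along zero    = refl
  along (suc t) = trans (inv (next^ t fz)) (along t)

nondecreasing⇒constant : (f : Vector ℕ (suc m)) → (∀ i → f i ≤ f (next i)) → ∀ i → f i ≡ f fz
nondecreasing⇒constant f mono = shift-invariant⇒constant f λ i →
  sym (∑-mono-≡⇒≗ mono (∑-next^ 1 f) i)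

nonincreasing⇒constant : (f : Vector ℕ (suc m)) → (∀ i → f (next i) ≤ f i) → ∀ i → f i ≡ f fz
nonincreasing⇒constant f mono = shift-invariant⇒constant f
  (∑-mono-≡⇒≗ mono (sym (∑-next^ 1 f)))

δ : ∀ {n} → Fin n → Fin n → ℕ
δ i j = [ ⌊ i F.≟ j ⌋ ]

δ-refl : ∀ {n} (i : Fin n) → δ i i ≡ 1
δ-refl i with i F.≟ i
... | yes _  = refl
... | no i≢i = ⊥-elim (i≢i refl)

δ-≢ : ∀ {n} {i j : Fin n} → i ≢ j → δ i j ≡ 0
δ-≢ {i = i} {j} i≢j with i F.≟ j
... | yes i≡j = ⊥-elim (i≢j i≡j)
... | no _    = refl

δ-sym : ∀ {n} (i j : Fin n) → δ i j ≡ δ j i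
δ-sym i j with i F.≟ j
... | yes refl = sym (δ-refl i)
... | no i≢j   = sym (δ-≢ (i≢j ∘ sym))

δ-next : (e i : Fin (suc m)) → δ (next e) i ≡ δ e (prev i)
δ-next e i with next e F.≟ i
... | yes refl = sym (trans (cong (δ e) (prev-next e)) (δ-refl e))
... | no ne≢i  = sym (δ-≢ λ e≡pi → ne≢i (trans (cong next e≡pi) (next-prev i)))

δ-suc : ∀ {n} (i j : Fin n) → δ (fs i) (fs j) ≡ δ i j
δ-suc i j = cong [_] (⌊⌋-map′ _ _ (i F.≟ j))

∑-δʳ : ∀ {n} (i : Fin n) (f : Vector ℕ n) → ∑ (λ j → δ i j * f j) ≡ f i
∑-δʳ {suc n} fz     f = trans (cong (f fz + 0 +_) (trans (∑-const n 0) (*-zeroʳ n)))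
                              (trans (+-identityʳ _) (+-identityʳ (f fz)))
∑-δʳ {suc n} (fs i) f = trans (sum-cong-≗ λ j → cong (_* f (fs j)) (δ-suc i j)) (∑-δʳ i (f ∘ fs))

∑-δˡ : ∀ {n} (i : Fin n) (f : Vector ℕ n) → ∑ (λ j → δ j i * f j) ≡ f i
∑-δˡ i f = trans (sum-cong-≗ λ j → cong (_* f j) (δ-sym j i)) (∑-δʳ i f)

∑-δ-one : ∀ {n} (i : Fin n) → ∑ (λ j → δ j i) ≡ 1
∑-δ-one i = trans (sum-cong-≗ λ j → sym (*-identityʳ (δ j i))) (∑-δˡ i (λ _ → 1))

δ≤ : ∀ {n} {f : Vector ℕ n} {j} → 1 ≤ f j → ∀ i → δ i j ≤ f i
δ≤ {j = j} 1≤fj i with i F.≟ j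
... | yes refl = 1≤fj
... | no _     = z≤n

infixl 7 _÷_

-- Total division, with the junk value a ÷ 0 = 0.
_÷_ : ℕ → ℕ → ℕ
a ÷ zero  = 0
a ÷ suc x = a / suc x

+-*-÷ : ∀ a e {x} → 1 ≤ x → (a + e * x) ÷ x ≡ a ÷ x + e
+-*-÷ a e {suc x} _ = trans (+-distrib-/-∣ʳ a (divides e refl)) (cong (a / suc x +_) (m*n/n≡m e (suc x)))

*-÷ : ∀ e {x} → 1 ≤ x → e * x ÷ x ≡ e
*-÷ e {suc x} _ = m*n/n≡m e (suc x)

÷-*-∣ : ∀ {a x} → 1 ≤ x → x ∣ a → a ÷ x * x ≡ a
÷-*-∣ {x = suc x} _ x∣a = m/n*n≡m x∣a

n÷n≡1 : ∀ {x} → 1 ≤ x → x ÷ x ≡ 1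
n÷n≡1 {suc x} _ = n/n≡1 (suc x)

<⇒÷≡0 : ∀ {a x} → a < x → a ÷ x ≡ 0
<⇒÷≡0 {x = suc x} a<x = m<n⇒m/n≡0 a<x

pred÷≡0⇔≤ : ∀ {x y} → 1 ≤ x → 1 ≤ y → (y ∸ 1) ÷ x ≡ 0 ⇔ y ≤ x
pred÷≡0⇔≤ {suc x} {suc y} _ _ = mk⇔ m/n≡0⇒m<n m<n⇒m/n≡0

neighbours : Vector ℕ (suc m) → Fin (suc m) → ℕ
neighbours r i = r (prev i) + r (next i)

record Arithmetical (r : Vector ℕ (suc m)) : Set where
  field
    positive : ∀ i → 1 ≤ r i
    divides-neighbours : ∀ i → r i ∣ neighbours r i

open Arithmetical

Primitive : Vector ℕ (suc m) → Set
Primitive r = ∀ g → (∀ i → g ∣ r i) → g ∣ 1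

dOf : Vector ℕ (suc m) → Vector ℕ (suc m)
dOf r i = neighbours r i ÷ r i

code : Vector ℕ (suc m) → Vector ℕ (suc m)
code r i = (r (next i) ∸ 1) ÷ r i

dOf-*-≡-neighbours : ∀ {r : Vector ℕ (suc m)} → Arithmetical r → ∀ i → dOf r i * r i ≡ neighbours r i
dOf-*-≡-neighbours a i = ÷-*-∣ (positive a i) (divides-neighbours a i)

code≡0⇔≤ : ∀ {r : Vector ℕ (suc m)} → Arithmetical r → ∀ i → code r i ≡ 0 ⇔ r (next i) ≤ r i
code≡0⇔≤ a i = pred÷≡0⇔≤ (positive a i) (positive a (next i))

module _ {σ : Fin (suc m) → Fin (suc m)} (equivariant : Shift-equivariant σ) (r : Vector ℕ (suc m)) where

  neighbours-∘ : ∀ i → neighbours (r ∘ σ) i ≡ neighbours r (σ i)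
  neighbours-∘ i = cong₂ _+_ (cong r (equivariant-prev equivariant i)) (cong r (equivariant i))

  arithmetical-∘ : Arithmetical r → Arithmetical (r ∘ σ)
  arithmetical-∘ a = record
    { positive           = positive a ∘ σ
    ; divides-neighbours = λ i → subst (r (σ i) ∣_) (sym (neighbours-∘ i)) (divides-neighbours a (σ i))
    }

  dOf-∘ : ∀ i → dOf (r ∘ σ) i ≡ dOf r (σ i)
  dOf-∘ i = cong (_÷ r (σ i)) (neighbours-∘ i)

  code-∘ : ∀ i → code (r ∘ σ) i ≡ code r (σ i)
  code-∘ i = cong (λ j → (r j ∸ 1) ÷ r (σ i)) (equivariant i)

module _ {r s : Vector ℕ (suc m)} (r≗s : r ≗ s) where

  neighbours-cong : ∀ i → neighbours r i ≡ neighbours s i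
  neighbours-cong i = cong₂ _+_ (r≗s (prev i)) (r≗s (next i))

  dOf-cong : dOf r ≗ dOf s
  dOf-cong i = cong₂ _÷_ (neighbours-cong i) (r≗s i)

  code-cong : code r ≗ code s
  code-cong i = cong₂ (λ a b → (a ∸ 1) ÷ b) (r≗s (next i)) (r≗s i)

  arithmetical-cong : Arithmetical r → Arithmetical s
  arithmetical-cong a = record
    { positive           = λ i → subst (1 ≤_) (r≗s i) (positive a i)
    ; divides-neighbours = λ i → subst₂ _∣_ (r≗s i) (neighbours-cong i) (divides-neighbours a i)
    }

-- The new vertex 0 sits between the old last vertex and the old vertex 0.
subdivide : Vector ℕ (suc m) → Vector ℕ (suc (suc m))
subdivide {m} r fz     = r (fromℕ m) + r fz
subdivide     r (fs i) = r i

subdivide-cong : ∀ {r s : Vector ℕ (suc m)} → r ≗ s → subdivide r ≗ subdivide s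
subdivide-cong {m} r≗s fz     = cong₂ _+_ (r≗s (fromℕ m)) (r≗s fz)
subdivide-cong     r≗s (fs i) = r≗s i

subdivide-prev : ∀ (r : Vector ℕ (suc m)) i → subdivide r (prev (fs i)) ≡ r (prev i) + δ i fz * r i
subdivide-prev r fz     = cong (r (prev fz) +_) (sym (+-identityʳ (r fz)))
subdivide-prev r (fs i) = sym (+-identityʳ _)

subdivide-next : ∀ (r : Vector ℕ (suc m)) i → subdivide r (next (fs i)) ≡ r (next i) + δ i (fromℕ m) * r i
subdivide-next {m} r i with initOrLast i
... | init j rewrite next-inject₁ (fs j) | next-inject₁ j | δ-≢ (fromℕ≢inject₁ {i = j} ∘ sym) =
  sym (+-identityʳ _)
... | last rewrite next-fromℕ (suc m) | next-fromℕ m | δ-refl (fromℕ m) =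
  trans (+-comm (r (fromℕ m)) (r fz)) (cong (r fz +_) (sym (+-identityʳ _)))

neighbours-subdivide-fz : (r : Vector ℕ (suc m)) → neighbours (subdivide r) fz ≡ subdivide r fz
neighbours-subdivide-fz {m} r = cong (λ j → r (fromℕ m) + subdivide r j) (next-inject₁ fz)

neighbours-subdivide-fs : ∀ (r : Vector ℕ (suc m)) i →
  neighbours (subdivide r) (fs i) ≡ neighbours r i + (δ i fz + δ i (fromℕ m)) * r i
neighbours-subdivide-fs {m} r i = trans (cong₂ _+_ (subdivide-prev r i) (subdivide-next r i))
  (interchange (r (prev i)) (δ i fz) (r (next i)) (δ i (fromℕ m)) (r i))
  where
  interchange : ∀ a x b y z → a + x * z + (b + y * z) ≡ a + b + (x + y) * z
  interchange = solve-∀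

module _ {r : Vector ℕ (suc m)} (a : Arithmetical r) where

  arithmetical-subdivide : Arithmetical (subdivide r)
  arithmetical-subdivide = record { positive = pos ; divides-neighbours = div }
    where
    pos : ∀ i → 1 ≤ subdivide r i
    pos fz     = ≤-trans (positive a (fromℕ m)) (m≤m+n _ _)
    pos (fs i) = positive a i
    div : ∀ i → subdivide r i ∣ neighbours (subdivide r) i
    div fz     = subst (subdivide r fz ∣_) (sym (neighbours-subdivide-fz r)) ∣-refl
    div (fs i) = subst (r i ∣_) (sym (neighbours-subdivide-fs r i))
                   (∣m∣n⇒∣m+n (divides-neighbours a i) (n∣m*n (δ i fz + δ i (fromℕ m))))

  dOf-subdivide-fz : dOf (subdivide r) fz ≡ 1
  dOf-subdivide-fz = trans (cong (_÷ subdivide r fz) (neighbours-subdivide-fz r))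
                           (n÷n≡1 (positive arithmetical-subdivide fz))

  dOf-subdivide-fs : ∀ i → dOf (subdivide r) (fs i) ≡ dOf r i + (δ i fz + δ i (fromℕ m))
  dOf-subdivide-fs i = trans (cong (_÷ r i) (neighbours-subdivide-fs r i))
                             (+-*-÷ (neighbours r i) _ (positive a i))

  ∑-dOf-subdivide : ∑ (dOf (subdivide r)) ≡ 3 + ∑ (dOf r)
  ∑-dOf-subdivide = begin
    dOf (subdivide r) fz + ∑ (dOf (subdivide r) ∘ fs)
      ≡⟨ cong₂ _+_ dOf-subdivide-fz (sum-cong-≗ dOf-subdivide-fs) ⟩
    1 + ∑ (λ i → dOf r i + (δ i fz + δ i (fromℕ m)))
      ≡⟨ cong suc (∑-distrib-+ (dOf r) (λ i → δ i fz + δ i (fromℕ m))) ⟩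
    1 + (∑ (dOf r) + ∑ (λ i → δ i fz + δ i (fromℕ m)))
      ≡⟨ cong (λ x → 1 + (∑ (dOf r) + x)) ∑-δ-ends ⟩
    1 + (∑ (dOf r) + 2)
      ≡⟨ cong suc (+-comm (∑ (dOf r)) 2) ⟩
    3 + ∑ (dOf r)
      ∎
    where
    open ≡-Reasoning
    ∑-δ-ends : ∑ (λ i → δ i fz + δ i (fromℕ m)) ≡ 2
    ∑-δ-ends = trans (∑-distrib-+ (λ i → δ i fz) (λ i → δ i (fromℕ m)))
                     (cong₂ _+_ (∑-δ-one {suc m} fz) (∑-δ-one (fromℕ m)))

arithmetical-subdivide⁻ : ∀ {r : Vector ℕ (suc m)} → Arithmetical (subdivide r) → Arithmetical r
arithmetical-subdivide⁻ {m} {r} a = record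
  { positive           = positive a ∘ fs
  ; divides-neighbours = λ i → ∣m+n∣m⇒∣n
      (subst (r i ∣_) (trans (neighbours-subdivide-fs r i) (+-comm (neighbours r i) _))
        (divides-neighbours a (fs i)))
      (n∣m*n (δ i fz + δ i (fromℕ m)))
  }

subdivideCode : Vector ℕ (suc m) → Vector ℕ (suc (suc m))
subdivideCode     c fz     = 0
subdivideCode {m} c (fs i) = c i + δ i (fromℕ m)

contractCode : Vector ℕ (suc (suc m)) → Vector ℕ (suc m)
contractCode {m} c i = c (fs i) ∸ δ i (fromℕ m)

∑-subdivideCode : (c : Vector ℕ (suc m)) → ∑ (subdivideCode c) ≡ 1 + ∑ c
∑-subdivideCode {m} c = trans (∑-distrib-+ c (λ i → δ i (fromℕ m)))
  (trans (cong (∑ c +_) (∑-δ-one (fromℕ m))) (+-comm (∑ c) 1))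

contractCode-subdivideCode : (c : Vector ℕ (suc m)) → contractCode (subdivideCode c) ≗ c
contractCode-subdivideCode {m} c i = m+n∸n≡m (c i) (δ i (fromℕ m))

subdivideCode-contractCode : (c : Vector ℕ (suc (suc m))) → c fz ≡ 0 → 1 ≤ c (fs (fromℕ m)) →
                             subdivideCode (contractCode c) ≗ c
subdivideCode-contractCode c c₀≡0 _     fz     = sym c₀≡0
subdivideCode-contractCode c _    1≤cₗ (fs i) = m∸n+n≡m (δ≤ {f = c ∘ fs} 1≤cₗ i)

code-subdivide : ∀ {r : Vector ℕ (suc m)} → Arithmetical r → code (subdivide r) ≗ subdivideCode (code r)
code-subdivide {m} {r} a fz = trans (cong (λ j → (subdivide r j ∸ 1) ÷ subdivide r fz) (next-inject₁ fz))
  (<⇒÷≡0 (≤-<-trans (m∸n≤m (r fz) 1) (m<n+m (r fz) (positive a (fromℕ m)))))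
code-subdivide {m} {r} a (fs i) = begin
  (subdivide r (next (fs i)) ∸ 1) ÷ r i
    ≡⟨ cong (λ x → (x ∸ 1) ÷ r i) (subdivide-next r i) ⟩
  (r (next i) + δ i (fromℕ m) * r i ∸ 1) ÷ r i
    ≡⟨ cong (_÷ r i) (+-∸-comm _ (positive a (next i))) ⟩
  (r (next i) ∸ 1 + δ i (fromℕ m) * r i) ÷ r i
    ≡⟨ +-*-÷ (r (next i) ∸ 1) (δ i (fromℕ m)) (positive a i) ⟩
  code r i + δ i (fromℕ m) ∎
  where open ≡-Reasoning

SumFormula : Vector ℕ (suc m) → Set
SumFormula {m} r = ∑ (dOf r) ≡ 2 * suc m + ∑ (code r)

sumFormula-subdivide : ∀ {r : Vector ℕ (suc m)} → Arithmetical r → SumFormula r → SumFormula (subdivide r)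
sumFormula-subdivide {m} {r} a formula = begin
  ∑ (dOf (subdivide r))                         ≡⟨ ∑-dOf-subdivide a ⟩
  3 + ∑ (dOf r)                                 ≡⟨ cong (3 +_) formula ⟩
  3 + (2 * suc m + ∑ (code r))                  ≡⟨ regroup m (∑ (code r)) ⟩
  2 * suc (suc m) + (1 + ∑ (code r))            ≡⟨ cong (n′ +_) (∑-subdivideCode (code r)) ⟨
  2 * suc (suc m) + ∑ (subdivideCode (code r))  ≡⟨ cong (n′ +_) (sum-cong-≗ (code-subdivide a)) ⟨
  2 * suc (suc m) + ∑ (code (subdivide r))      ∎
  where
  open ≡-Reasoning
  n′ : ℕ
  n′ = 2 * suc (suc m)
  regroup : ∀ m s → 3 + (2 * suc m + s) ≡ 2 * suc (suc m) + (1 + s)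
  regroup = solve-∀

sumFormula-cong : ∀ {r s : Vector ℕ (suc m)} → r ≗ s → SumFormula r → SumFormula s
sumFormula-cong {m} r≗s formula =
  trans (sum-cong-≗ (sym ∘ dOf-cong r≗s))
        (trans formula (cong (2 * suc m +_) (sum-cong-≗ (code-cong r≗s))))

sumFormula-prev^ : ∀ t {r : Vector ℕ (suc m)} → SumFormula r → SumFormula (r ∘ prev^ t)
sumFormula-prev^ {m} t {r} formula = begin
  ∑ (dOf (r ∘ prev^ t))              ≡⟨ sum-cong-≗ (dOf-∘ (prev^-equivariant t) r) ⟩
  ∑ (dOf r ∘ prev^ t)                ≡⟨ ∑-prev^ t (dOf r) ⟨
  ∑ (dOf r)                          ≡⟨ formula ⟩
  2 * suc m + ∑ (code r)             ≡⟨ cong (2 * suc m +_) (∑-prev^ t (code r)) ⟩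
  2 * suc m + ∑ (code r ∘ prev^ t)   ≡⟨ cong (2 * suc m +_) (sum-cong-≗ (code-∘ (prev^-equivariant t) r)) ⟨
  2 * suc m + ∑ (code (r ∘ prev^ t)) ∎
  where open ≡-Reasoning

sumFormula-ones : SumFormula {m} (λ _ → 1)
sumFormula-ones {m} = begin
  ∑ {suc m} (λ _ → 2)         ≡⟨ ∑-const (suc m) 2 ⟩
  suc m * 2                   ≡⟨ *-comm (suc m) 2 ⟩
  2 * suc m                   ≡⟨ +-identityʳ _ ⟨
  2 * suc m + 0               ≡⟨ cong (2 * suc m +_) (trans (∑-const (suc m) 0) (*-zeroʳ (suc m))) ⟨
  2 * suc m + ∑ {suc m} (λ _ → 0) ∎
  where open ≡-Reasoning

Pattern : Vector ℕ (suc m) → Fin (suc m) → Set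
Pattern c v = 1 ≤ c (prev v) × c v ≡ 0

pattern? : (c : Vector ℕ (suc m)) → Dec (∃ (Pattern c))
pattern? c = any? λ v → (1 ≤? c (prev v)) ×-dec (c v ≟ 0)

pattern-cong : ∀ {c c′ : Vector ℕ (suc m)} {v} → c ≗ c′ → Pattern c v → Pattern c′ v
pattern-cong {v = v} c≗c′ (1≤c₋ , c≡0) = subst (1 ≤_) (c≗c′ (prev v)) 1≤c₋ , trans (sym (c≗c′ v)) c≡0

no-pattern-on-loop : (c : Vector ℕ 1) → ¬ ∃ (Pattern c)
no-pattern-on-loop c (fz , 1≤c , c≡0) = <-irrefl (sym c≡0) 1≤c

pattern-rotate : ∀ {c : Vector ℕ (suc m)} {v} → Pattern c v → Pattern (c ∘ next^ (toℕ v)) fz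
pattern-rotate {c = c} {v} (1≤c₋ , c≡0) =
  subst (λ j → 1 ≤ c j) (sym prev-rotated) 1≤c₋ , trans (cong c (next^-toℕ v)) c≡0
  where
  prev-rotated : next^ (toℕ v) (prev fz) ≡ prev v
  prev-rotated = trans (equivariant-prev (next^-equivariant (toℕ v)) fz) (cong prev (next^-toℕ v))

-- The signs of c are nondecreasing along the cycle, hence constant.
zeros-without-pattern : (c : Vector ℕ (suc m)) → ∃[ j ] c j ≡ 0 → ¬ ∃ (Pattern c) → ∀ i → c i ≡ 0
zeros-without-pattern c (j , cⱼ≡0) no-pattern i = sign≡0 (c i) (begin
  sign (c i)  ≡⟨ nondecreasing⇒constant (sign ∘ c) sign-mono i ⟩
  sign (c fz) ≡⟨ nondecreasing⇒constant (sign ∘ c) sign-mono j ⟨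
  sign (c j)  ≡⟨ cong sign cⱼ≡0 ⟩
  0           ∎)
  where
  open ≡-Reasoning
  sign : ℕ → ℕ
  sign zero    = 0
  sign (suc _) = 1
  sign≡0 : ∀ x → sign x ≡ 0 → x ≡ 0
  sign≡0 zero _ = refl
  sign-mono : ∀ i → sign (c i) ≤ sign (c (next i))
  sign-mono i with c i in cᵢ | c (next i) in cₙ
  ... | zero  | _     = z≤n
  ... | suc _ | suc _ = ≤-refl
  ... | suc _ | zero  = ⊥-elim (no-pattern (next i ,
          subst (λ j → 1 ≤ c j) (sym (prev-next i)) (subst (1 ≤_) (sym cᵢ) (s≤s z≤n)) , cₙ))

code-has-zero : ∀ {r : Vector ℕ (suc m)} → Arithmetical r → ∃[ i ] code r i ≡ 0
code-has-zero {r = r} a with any? (λ i → code r i ≟ 0)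
... | yes zero-entry = zero-entry
... | no  no-zero    = ⊥-elim (<-irrefl (sym (constant (next fz))) (increasing fz))
  where
  increasing : ∀ i → r i < r (next i)
  increasing i = ≰⇒> λ rₙ≤rᵢ → no-zero (i , Equivalence.from (code≡0⇔≤ a i) rₙ≤rᵢ)
  constant : ∀ i → r i ≡ r fz
  constant = nondecreasing⇒constant r (<⇒≤ ∘ increasing)

ones-without-pattern : ∀ {r : Vector ℕ (suc m)} → Arithmetical r → Primitive r →
                       ¬ ∃ (Pattern (code r)) → ∀ i → r i ≡ 1
ones-without-pattern {r = r} a prim no-pattern i = trans (constant i) r₀≡1
  where
  constant : ∀ i → r i ≡ r fz
  constant = nonincreasing⇒constant r λ i → Equivalence.to (code≡0⇔≤ a i)
    (zeros-without-pattern (code r) (code-has-zero a) no-pattern i)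
  r₀≡1 : r fz ≡ 1
  r₀≡1 = ∣1⇒≡1 (prim (r fz) λ j → subst (r fz ∣_) (sym (constant j)) ∣-refl)

∣-sum-of-smaller : ∀ {a b x} → 1 ≤ b → a < x → b ≤ x → x ∣ a + b → x ≡ a + b
∣-sum-of-smaller {a} {b} 1≤b _ _ (divides zero a+b≡0) =
  ⊥-elim (<-irrefl (sym a+b≡0) (≤-trans 1≤b (m≤n+m b a)))
∣-sum-of-smaller _ _ _ (divides (suc zero) a+b≡x) = sym (trans a+b≡x (+-identityʳ _))
∣-sum-of-smaller {a} {b} {x} _ a<x b≤x (divides (suc (suc k)) a+b≡kx) = ⊥-elim (<-irrefl refl (begin-strict
  x + x           ≤⟨ +-monoʳ-≤ x (m≤m+n x (k * x)) ⟩
  x + (x + k * x) ≡⟨ a+b≡kx ⟨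
  a + b           <⟨ +-mono-<-≤ a<x b≤x ⟩
  x + x           ∎))
  where open ≤-Reasoning

pattern⇒neighbour-sum : ∀ {r : Vector ℕ (suc m)} {v} → Arithmetical r → Pattern (code r) v →
                        r v ≡ neighbours r v
pattern⇒neighbour-sum {r = r} {v} a (1≤c₋ , c≡0) =
  ∣-sum-of-smaller (positive a (next v)) r₋<r (Equivalence.to (code≡0⇔≤ a v) c≡0) (divides-neighbours a v)
  where
  r₋<r : r (prev v) < r v
  r₋<r = subst (λ j → r (prev v) < r j) (next-prev v)
    (≰⇒> λ rᵥ≤r₋ → <-irrefl (sym (Equivalence.from (code≡0⇔≤ a (prev v)) rᵥ≤r₋)) 1≤c₋)

subdivide-tail : (r : Vector ℕ (suc (suc m))) → r fz ≡ neighbours r fz → r ≗ subdivide (r ∘ fs)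
subdivide-tail {m} r r₀≡ fz     = trans r₀≡ (cong (λ j → r (fs (fromℕ m)) + r j) (next-inject₁ fz))
subdivide-tail     r _   (fs i) = refl

unit⇒primitive : ∀ {r : Vector ℕ (suc m)} → ∃[ i ] r i ≡ 1 → Primitive r
unit⇒primitive (i , rᵢ≡1) g g∣r = subst (g ∣_) rᵢ≡1 (g∣r i)

primitive-cong : ∀ {r s : Vector ℕ (suc m)} → r ≗ s → Primitive r → Primitive s
primitive-cong r≗s prim g g∣s = prim g λ i → subst (g ∣_) (sym (r≗s i)) (g∣s i)

primitive-next^ : ∀ t {r : Vector ℕ (suc m)} → Primitive r → Primitive (r ∘ next^ t)
primitive-next^ t {r} prim g g∣r = prim g λ i → subst (g ∣_) (cong r (next^-prev^ t i)) (g∣r (prev^ t i))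

primitive-subdivide⁻ : ∀ {r : Vector ℕ (suc m)} → Primitive (subdivide r) → Primitive r
primitive-subdivide⁻ {m} prim g g∣r = prim g λ where
  fz     → ∣m∣n⇒∣m+n (g∣r (fromℕ m)) (g∣r fz)
  (fs i) → g∣r i

module Peel {r : Vector ℕ (suc (suc m))} {v} (a : Arithmetical r) (p : Pattern (code r) v) where

  t : ℕ
  t = toℕ v

  peeled : Vector ℕ (suc m)
  peeled = r ∘ next^ t ∘ fs

  rotated≗subdivide : r ∘ next^ t ≗ subdivide peeled
  rotated≗subdivide = subdivide-tail (r ∘ next^ t) (begin
    r (next^ t fz)               ≡⟨ cong r (next^-toℕ v) ⟩
    r v                          ≡⟨ pattern⇒neighbour-sum a p ⟩
    neighbours r v               ≡⟨ cong (neighbours r) (next^-toℕ v) ⟨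
    neighbours r (next^ t fz)    ≡⟨ neighbours-∘ {σ = next^ t} (next^-equivariant t) r fz ⟨
    neighbours (r ∘ next^ t) fz  ∎)
    where open ≡-Reasoning

  r≗subdivide : r ≗ subdivide peeled ∘ prev^ t
  r≗subdivide i = trans (cong r (sym (next^-prev^ t i))) (rotated≗subdivide (prev^ t i))

  arithmetical-peeled : Arithmetical peeled
  arithmetical-peeled = arithmetical-subdivide⁻
    (arithmetical-cong rotated≗subdivide (arithmetical-∘ (next^-equivariant t) r a))

  primitive-peeled : Primitive r → Primitive peeled
  primitive-peeled prim = primitive-subdivide⁻ (primitive-cong rotated≗subdivide (primitive-next^ t prim))

  code-peeled : contractCode (code r ∘ next^ t) ≗ code peeled
  code-peeled i = begin
    code r (next^ t (fs i)) ∸ δ i (fromℕ m)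
      ≡⟨ cong (_∸ δ i (fromℕ m)) (code-∘ {σ = next^ t} (next^-equivariant t) r (fs i)) ⟨
    code (r ∘ next^ t) (fs i) ∸ δ i (fromℕ m)
      ≡⟨ cong (_∸ δ i (fromℕ m)) (code-cong rotated≗subdivide (fs i)) ⟩
    code (subdivide peeled) (fs i) ∸ δ i (fromℕ m)
      ≡⟨ cong (_∸ δ i (fromℕ m)) (code-subdivide arithmetical-peeled (fs i)) ⟩
    contractCode (subdivideCode (code peeled)) i
      ≡⟨ contractCode-subdivideCode (code peeled) i ⟩
    code peeled i ∎
    where open ≡-Reasoning

sumFormula : ∀ {r : Vector ℕ (suc m)} → Arithmetical r → Primitive r → SumFormula r
sumFormula {zero} {r} a prim =
  sumFormula-cong (sym ∘ ones-without-pattern a prim (no-pattern-on-loop (code r))) (sumFormula-ones {0})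
sumFormula {suc m} {r} a prim with pattern? (code r)
... | no no-pattern = sumFormula-cong (sym ∘ ones-without-pattern a prim no-pattern) (sumFormula-ones {suc m})
... | yes (v , p)   = sumFormula-cong (sym ∘ r≗subdivide)
  (sumFormula-prev^ t {subdivide peeled} (sumFormula-subdivide arithmetical-peeled
    (sumFormula arithmetical-peeled (primitive-peeled prim))))
  where open Peel a p

decode : Vec ℕ (suc m) → Vector ℕ (suc m)
decode {zero}  c = λ _ → 1
decode {suc m} c with pattern? (lookup c)
... | yes (v , _) = subdivide (decode (tabulate (contractCode (lookup c ∘ next^ (toℕ v))))) ∘ prev^ (toℕ v)
... | no _        = λ _ → 1

decode-code : ∀ {r : Vector ℕ (suc m)} → Arithmetical r → Primitive r → decode (tabulate (code r)) ≗ r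
decode-code {zero} {r} a prim i = sym (ones-without-pattern a prim (no-pattern-on-loop (code r)) i)
decode-code {suc m} {r} a prim with pattern? (lookup (tabulate (code r)))
... | no no-pattern = λ i → sym (ones-without-pattern a prim
        (λ (v , p) → no-pattern (v , pattern-cong (sym ∘ lookup∘tabulate (code r)) p)) i)
... | yes (v , p) = λ i → begin
  subdivide (decode (tabulate (contractCode (lookup (tabulate (code r)) ∘ next^ t)))) (prev^ t i)
    ≡⟨ cong (λ c → subdivide (decode c) (prev^ t i)) (tabulate-cong code-peeled′) ⟩
  subdivide (decode (tabulate (code peeled))) (prev^ t i)
    ≡⟨ subdivide-cong (decode-code arithmetical-peeled (primitive-peeled prim)) (prev^ t i) ⟩
  subdivide peeled (prev^ t i)
    ≡⟨ r≗subdivide i ⟨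
  r i ∎
  where
  open ≡-Reasoning
  open Peel a (pattern-cong {v = v} (lookup∘tabulate (code r)) p)
  code-peeled′ : contractCode (lookup (tabulate (code r)) ∘ next^ t) ≗ code peeled
  code-peeled′ i =
    trans (cong (_∸ δ i (fromℕ m)) (lookup∘tabulate (code r) (next^ t (fs i)))) (code-peeled i)

record IsDecoding (c r : Vector ℕ (suc m)) : Set where
  field
    arithmetical : Arithmetical r
    unit         : ∃[ i ] r i ≡ 1
    code≗        : code r ≗ c

open IsDecoding

isDecoding-ones : ∀ {c : Vector ℕ (suc m)} → (∀ i → c i ≡ 0) → IsDecoding c (λ _ → 1)
isDecoding-ones c≡0 = record
  { arithmetical = record { positive = λ _ → ≤-refl ; divides-neighbours = λ _ → 1∣ _ }
  ; unit         = fz , refl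
  ; code≗        = sym ∘ c≡0
  }

isDecoding-cong : ∀ {c c′ r : Vector ℕ (suc m)} → c ≗ c′ → IsDecoding c r → IsDecoding c′ r
isDecoding-cong c≗c′ d = record
  { arithmetical = arithmetical d ; unit = unit d ; code≗ = λ i → trans (code≗ d i) (c≗c′ i) }

isDecoding-subdivide : ∀ {c r : Vector ℕ (suc m)} → IsDecoding c r →
                       IsDecoding (subdivideCode c) (subdivide r)
isDecoding-subdivide {m} {c} {r} d = record
  { arithmetical = arithmetical-subdivide (arithmetical d)
  ; unit         = let (i , rᵢ≡1) = unit d in fs i , rᵢ≡1
  ; code≗        = λ i → trans (code-subdivide (arithmetical d) i) (subdivideCode-cong i)
  }
  where
  subdivideCode-cong : subdivideCode (code r) ≗ subdivideCode c
  subdivideCode-cong fz     = refl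
  subdivideCode-cong (fs i) = cong (_+ δ i (fromℕ m)) (code≗ d i)

isDecoding-prev^ : ∀ t {c r : Vector ℕ (suc m)} → IsDecoding c r → IsDecoding (c ∘ prev^ t) (r ∘ prev^ t)
isDecoding-prev^ t {c} {r} d = record
  { arithmetical = arithmetical-∘ (prev^-equivariant t) r (arithmetical d)
  ; unit         = let (i , rᵢ≡1) = unit d in next^ t i , trans (cong r (prev^-next^ t i)) rᵢ≡1
  ; code≗        = λ i → trans (code-∘ (prev^-equivariant t) r i) (code≗ d (prev^ t i))
  }

has-zero : (c : Vector ℕ (suc m)) → ∑ c < suc m → ∃[ j ] c j ≡ 0
has-zero {m} c ∑c<n with any? (λ j → c j ≟ 0)
... | yes zero-entry = zero-entry
... | no  no-zero    = ⊥-elim (<⇒≱ ∑c<n (begin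
  suc m                ≡⟨ *-identityʳ (suc m) ⟨
  suc m * 1            ≡⟨ ∑-const (suc m) 1 ⟨
  ∑ {suc m} (λ _ → 1)  ≤⟨ ∑-mono-≤ (λ i → n≢0⇒n>0 λ cᵢ≡0 → no-zero (i , cᵢ≡0)) ⟩
  ∑ c                  ∎))
  where open ≤-Reasoning

decode-correct : (c : Vec ℕ (suc m)) → ∑ (lookup c) < suc m → IsDecoding (lookup c) (decode c)
decode-correct {zero} c ∑c<1 with has-zero (lookup c) ∑c<1
... | fz , c₀≡0 = isDecoding-ones λ { fz → c₀≡0 }
decode-correct {suc m} c ∑c<n with pattern? (lookup c)
... | no no-pattern =
  isDecoding-ones (zeros-without-pattern (lookup c) (has-zero (lookup c) ∑c<n) no-pattern)
... | yes (v , p) =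
  isDecoding-cong (λ i → cong (lookup c) (next^-prev^ t i))
    (isDecoding-prev^ t (isDecoding-cong rotated≗
      (isDecoding-subdivide (isDecoding-cong (lookup∘tabulate (contractCode rotated))
        (decode-correct contracted ∑contracted<n)))))
  where
  t : ℕ
  t = toℕ v
  rotated : Vector ℕ (suc (suc m))
  rotated = lookup c ∘ next^ t
  rotated≗ : subdivideCode (contractCode rotated) ≗ rotated
  rotated≗ = let (1≤c₋ , c₀≡0) = pattern-rotate {c = lookup c} {v} p in
             subdivideCode-contractCode rotated c₀≡0 1≤c₋
  contracted : Vec ℕ (suc m)
  contracted = tabulate (contractCode rotated)
  ∑contracted<n : ∑ (lookup contracted) < suc m
  ∑contracted<n = ≤-pred (begin-strict
    suc (∑ (lookup contracted))               ≡⟨ cong suc (sum-cong-≗ (lookup∘tabulate (contractCode rotated))) ⟩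
    suc (∑ (contractCode rotated))            ≡⟨ ∑-subdivideCode (contractCode rotated) ⟨
    ∑ (subdivideCode (contractCode rotated))  ≡⟨ sum-cong-≗ rotated≗ ⟩
    ∑ rotated                                 ≡⟨ ∑-next^ t (lookup c) ⟨
    ∑ (lookup c)                              <⟨ ∑c<n ⟩
    suc (suc m)                               ∎)
    where open ≤-Reasoning

[∧]≡* : ∀ a b → [ a ∧ b ] ≡ [ a ] * [ b ]
[∧]≡* true  b = sym (+-identityʳ [ b ])
[∧]≡* false b = refl

edgeCount : Fin (suc m) → Fin (suc m) → Fin (suc m) → ℕ
edgeCount i j e = δ e i * δ (next e) j + δ e j * δ (next e) i

cycleAdj-edgeCount : ∀ (i j : Fin (suc m)) → cycleAdj (suc m) i j ≡ ∑ (edgeCount i j)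
cycleAdj-edgeCount i j =
  trans (sum-tabulate (λ e → [ ⌊ e F.≟ i ⌋ ∧ ⌊ next e F.≟ j ⌋ ] + [ ⌊ e F.≟ j ⌋ ∧ ⌊ next e F.≟ i ⌋ ]))
        (sum-cong-≗ λ e → cong₂ _+_ ([∧]≡* ⌊ e F.≟ i ⌋ ⌊ next e F.≟ j ⌋) ([∧]≡* ⌊ e F.≟ j ⌋ ⌊ next e F.≟ i ⌋))

∑-edgeCount-* : ∀ (f : Vector ℕ (suc m)) i e →
                ∑ (λ j → edgeCount i j e * f j) ≡ δ e i * f (next e) + δ e (prev i) * f e
∑-edgeCount-* f i e = begin
  ∑ (λ j → edgeCount i j e * f j)
    ≡⟨ sum-cong-≗ (λ j → distribute (δ e i) (δ (next e) j) (δ e j) (δ (next e) i) (f j)) ⟩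
  ∑ (λ j → δ e i * (δ (next e) j * f j) + δ (next e) i * (δ e j * f j))
    ≡⟨ ∑-distrib-+ (λ j → δ e i * (δ (next e) j * f j)) (λ j → δ (next e) i * (δ e j * f j)) ⟩
  ∑ (λ j → δ e i * (δ (next e) j * f j)) + ∑ (λ j → δ (next e) i * (δ e j * f j))
    ≡⟨ cong₂ _+_ (*-distribˡ-sum (δ e i) (λ j → δ (next e) j * f j))
                 (*-distribˡ-sum (δ (next e) i) (λ j → δ e j * f j)) ⟨
  δ e i * ∑ (λ j → δ (next e) j * f j) + δ (next e) i * ∑ (λ j → δ e j * f j)
    ≡⟨ cong₂ _+_ (cong (δ e i *_) (∑-δʳ (next e) f)) (cong₂ _*_ (δ-next e i) (∑-δʳ e f)) ⟩
  δ e i * f (next e) + δ e (prev i) * f e ∎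
  where
  open ≡-Reasoning
  distribute : ∀ a b c d x → (a * b + c * d) * x ≡ a * (b * x) + d * (c * x)
  distribute = solve-∀

∑-cycleAdj : ∀ (f : Vector ℕ (suc m)) i → sum (tabulate λ j → cycleAdj (suc m) i j * f j) ≡ neighbours f i
∑-cycleAdj {m} f i = begin
  sum (tabulate λ j → cycleAdj (suc m) i j * f j)
    ≡⟨ sum-tabulate (λ j → cycleAdj (suc m) i j * f j) ⟩
  ∑ (λ j → cycleAdj (suc m) i j * f j)
    ≡⟨ sum-cong-≗ (λ j → trans (cong (_* f j) (cycleAdj-edgeCount i j)) (*-distribʳ-sum (f j) (edgeCount i j))) ⟩
  ∑ (λ j → ∑ (λ e → edgeCount i j e * f j))
    ≡⟨ ∑-comm (λ j e → edgeCount i j e * f j) ⟩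
  ∑ (λ e → ∑ (λ j → edgeCount i j e * f j))
    ≡⟨ sum-cong-≗ (∑-edgeCount-* f i) ⟩
  ∑ (λ e → δ e i * f (next e) + δ e (prev i) * f e)
    ≡⟨ ∑-distrib-+ (λ e → δ e i * f (next e)) (λ e → δ e (prev i) * f e) ⟩
  ∑ (λ e → δ e i * f (next e)) + ∑ (λ e → δ e (prev i) * f e)
    ≡⟨ cong₂ _+_ (∑-δˡ i (f ∘ next)) (∑-δˡ (prev i) f) ⟩
  f (next i) + f (prev i)
    ≡⟨ +-comm (f (next i)) (f (prev i)) ⟩
  neighbours f i ∎
  where open ≡-Reasoning

suc-head : ∀ {n} → Vec ℕ (suc n) → Vec ℕ (suc n)
suc-head (x ∷ xs) = suc x ∷ xs

compositions : (n j : ℕ) → List (Vec ℕ n)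
compositions zero    zero    = [] ∷ []
compositions zero    (suc j) = []
compositions (suc n) zero    = map (0 ∷_) (compositions n zero)
compositions (suc n) (suc j) = map (0 ∷_) (compositions n (suc j)) ++ map suc-head (compositions (suc n) j)

length-compositions : ∀ n j → length (compositions (suc n) j) ≡ (n + j) C j
length-compositions n zero = length-zero (suc n)
  where
  length-zero : ∀ n → length (compositions n 0) ≡ 1
  length-zero zero    = refl
  length-zero (suc n) = trans (length-map (0 ∷_) (compositions n 0)) (length-zero n)
length-compositions zero (suc j) = begin
  length (map suc-head (compositions 1 j)) ≡⟨ length-map suc-head (compositions 1 j) ⟩
  length (compositions 1 j)                ≡⟨ length-compositions zero j ⟩
  j C j                                    ≡⟨ nCn≡1 j ⟩
  1                                        ≡⟨ nCn≡1 (suc j) ⟨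
  suc j C suc j                            ∎
  where open ≡-Reasoning
length-compositions (suc n) (suc j) = begin
  length (map (0 ∷_) (compositions (suc n) (suc j)) ++ map suc-head (compositions (suc (suc n)) j))
    ≡⟨ length-++ (map (0 ∷_) (compositions (suc n) (suc j))) ⟩
  length (map (0 ∷_) (compositions (suc n) (suc j))) + length (map suc-head (compositions (suc (suc n)) j))
    ≡⟨ cong₂ _+_ (trans (length-map (0 ∷_) (compositions (suc n) (suc j))) (length-compositions n (suc j)))
                 (trans (length-map suc-head (compositions (suc (suc n)) j)) (length-compositions (suc n) j)) ⟩
  (n + suc j) C suc j + (suc n + j) C j
    ≡⟨ cong (λ x → x C suc j + suc (n + j) C j) (+-suc n j) ⟩
  suc (n + j) C suc j + suc (n + j) C j
    ≡⟨ +-comm (suc (n + j) C suc j) _ ⟩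
  suc (n + j) C j + suc (n + j) C suc j
    ≡⟨ nCk+nC[k+1]≡[n+1]C[k+1] (suc (n + j)) j ⟩
  suc (suc (n + j)) C suc j
    ≡⟨ cong (λ x → suc x C suc j) (+-suc n j) ⟨
  (suc n + suc j) C suc j ∎
  where open ≡-Reasoning

∈-compositions⁻ : ∀ n j {v : Vec ℕ n} → v ∈ compositions n j → sum v ≡ j
∈-compositions⁻ zero zero (here refl) = refl
∈-compositions⁻ (suc n) zero v∈ with ∈-map⁻ (0 ∷_) v∈
... | w , w∈ , refl = ∈-compositions⁻ n zero w∈
∈-compositions⁻ (suc n) (suc j) v∈ with ∈-++⁻ (map (0 ∷_) (compositions n (suc j))) v∈
... | inj₁ v∈₀ with ∈-map⁻ (0 ∷_) v∈₀
...   | w , w∈ , refl = ∈-compositions⁻ n (suc j) w∈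
∈-compositions⁻ (suc n) (suc j) v∈ | inj₂ v∈₊ with ∈-map⁻ suc-head v∈₊
...   | x ∷ w , w∈ , refl = cong suc (∈-compositions⁻ (suc n) j w∈)

∈-compositions⁺ : ∀ n j (v : Vec ℕ n) → sum v ≡ j → v ∈ compositions n j
∈-compositions⁺ zero    zero    []          _  = here refl
∈-compositions⁺ (suc n) zero    (zero ∷ v)  Σ≡ = ∈-map⁺ (0 ∷_) (∈-compositions⁺ n zero v Σ≡)
∈-compositions⁺ (suc n) (suc j) (zero ∷ v)  Σ≡ = ∈-++⁺ˡ (∈-map⁺ (0 ∷_) (∈-compositions⁺ n (suc j) v Σ≡))
∈-compositions⁺ (suc n) (suc j) (suc x ∷ v) Σ≡ =
  ∈-++⁺ʳ (map (0 ∷_) (compositions n (suc j)))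
         (∈-map⁺ suc-head (∈-compositions⁺ (suc n) j (x ∷ v) (suc-injective Σ≡)))

compositions-unique : ∀ n j → Unique (compositions n j)
compositions-unique zero    zero    = [] ∷ []
compositions-unique zero    (suc j) = []
compositions-unique (suc n) zero    = Unique.map⁺ ∷-injectiveʳ (compositions-unique n zero)
compositions-unique (suc n) (suc j) = Unique.++⁺
  (Unique.map⁺ ∷-injectiveʳ (compositions-unique n (suc j)))
  (Unique.map⁺ suc-head-injective (compositions-unique (suc n) j))
  disjoint
  where
  suc-head-injective : ∀ {x y : Vec ℕ (suc n)} → suc-head x ≡ suc-head y → x ≡ y
  suc-head-injective {_ ∷ _} {_ ∷ _} refl = refl
  disjoint : ∀ {v} → ¬ (v ∈ map (0 ∷_) (compositions n (suc j)) × v ∈ map suc-head (compositions (suc n) j))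
  disjoint (v∈₀ , v∈₊) with ∈-map⁻ (0 ∷_) v∈₀ | ∈-map⁻ suc-head v∈₊
  ... | _ , _ , refl | _ ∷ _ , _ , ()

gcdVec-∣ : ∀ {n} (r : Vec ℕ n) i → gcdVec r ∣ lookup r i
gcdVec-∣ (x ∷ r) fz     = gcd[m,n]∣m x (gcdVec r)
gcdVec-∣ (x ∷ r) (fs i) = ∣-trans (gcd[m,n]∣n x (gcdVec r)) (gcdVec-∣ r i)

∣-gcdVec : ∀ {n} (r : Vec ℕ n) {g} → (∀ i → g ∣ lookup r i) → g ∣ gcdVec r
∣-gcdVec []      _   = _ ∣0
∣-gcdVec (x ∷ r) g∣r = gcd-greatest (g∣r fz) (∣-gcdVec r (g∣r ∘ fs))

dOf-positive : ∀ {r : Vector ℕ (suc m)} → Arithmetical r → ∀ i → 1 ≤ dOf r i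
dOf-positive {r = r} a i = n≢0⇒n>0 λ dᵢ≡0 →
  <-irrefl (trans (cong (_* r i) (sym dᵢ≡0)) (dOf-*-≡-neighbours a i))
           (≤-trans (positive a (prev i)) (m≤m+n _ _))

isArith-tabulate : ∀ {r : Vector ℕ (suc m)} → Arithmetical r → Primitive r →
                   IsArith (suc m) (tabulate (dOf r)) (tabulate r)
isArith-tabulate {m} {r} a prim =
  VecAll.lookup⁻ (λ i → subst (1 ≤_) (sym (lookup∘tabulate (dOf r) i)) (dOf-positive a i)) ,
  VecAll.lookup⁻ (λ i → subst (1 ≤_) (sym (lookup∘tabulate r i)) (positive a i)) ,
  ∣1⇒≡1 (prim _ λ i → subst (_ ∣_) (lookup∘tabulate r i) (gcdVec-∣ (tabulate r) i)) ,
  λ i → begin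
    lookup (tabulate (dOf r)) i * lookup (tabulate r) i
      ≡⟨ cong₂ _*_ (lookup∘tabulate (dOf r) i) (lookup∘tabulate r i) ⟩
    dOf r i * r i
      ≡⟨ dOf-*-≡-neighbours a i ⟩
    neighbours r i
      ≡⟨ neighbours-cong (lookup∘tabulate r) i ⟨
    neighbours (lookup (tabulate r)) i
      ≡⟨ ∑-cycleAdj (lookup (tabulate r)) i ⟨
    sum (tabulate λ j → cycleAdj (suc m) i j * lookup (tabulate r) j) ∎
  where open ≡-Reasoning

isArith⇒ : ∀ {d r : Vec ℕ (suc m)} → IsArith (suc m) d r →
           Arithmetical (lookup r) × Primitive (lookup r) × d ≡ tabulate (dOf (lookup r))
isArith⇒ {m} {d} {r} (d-pos , r-pos , gcd≡1 , balanced) = a , prim , d≡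
  where
  d*r≡ : ∀ i → lookup d i * lookup r i ≡ neighbours (lookup r) i
  d*r≡ i = trans (balanced i) (∑-cycleAdj (lookup r) i)
  a : Arithmetical (lookup r)
  a = record
    { positive           = VecAll.lookup⁺ r-pos
    ; divides-neighbours = λ i → divides (lookup d i) (sym (d*r≡ i))
    }
  prim : Primitive (lookup r)
  prim g g∣r = subst (g ∣_) gcd≡1 (∣-gcdVec r g∣r)
  d≡ : d ≡ tabulate (dOf (lookup r))
  d≡ = trans (sym (tabulate∘lookup d)) (tabulate-cong λ i →
         sym (trans (cong (_÷ lookup r i) (sym (d*r≡ i))) (*-÷ (lookup d i) (positive a i))))

module Counting (m j : ℕ) (j<n : j < suc m) where

  Structure : Vec ℕ (suc m) → Vec ℕ (suc m) → Set
  Structure d r = IsArith (suc m) d r × sum d ≡ 2 * suc m + j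

  structureOf : Vec ℕ (suc m) → Vec ℕ (suc m) × Vec ℕ (suc m)
  structureOf c = tabulate (dOf (decode c)) , tabulate (decode c)

  codeOf : Vec ℕ (suc m) × Vec ℕ (suc m) → Vec ℕ (suc m)
  codeOf (_ , r) = tabulate (code (lookup r))

  structures : List (Vec ℕ (suc m) × Vec ℕ (suc m))
  structures = map structureOf (compositions (suc m) j)

  decoding : ∀ {c} → c ∈ compositions (suc m) j → IsDecoding (lookup c) (decode c)
  decoding {c} c∈ =
    decode-correct c (subst (_< suc m) (trans (sym (∈-compositions⁻ (suc m) j c∈)) (sum-lookup c)) j<n)

  codeOf-structureOf : ∀ {c} → c ∈ compositions (suc m) j → codeOf (structureOf c) ≡ c
  codeOf-structureOf {c} c∈ = trans
    (tabulate-cong λ i → trans (code-cong (lookup∘tabulate (decode c)) i) (code≗ (decoding c∈) i))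
    (tabulate∘lookup c)

  structures-unique : Unique structures
  structures-unique = Unique.map⁻ {f = codeOf} (subst Unique (sym codes≡) (compositions-unique (suc m) j))
    where
    codes≡ : map codeOf structures ≡ compositions (suc m) j
    codes≡ = trans (sym (map-∘ (compositions (suc m) j)))
                   (map-id-local (ListAll.tabulate codeOf-structureOf))

  ∈⇒structure : ∀ {d r} → (d , r) ∈ structures → Structure d r
  ∈⇒structure d,r∈ with ∈-map⁻ structureOf d,r∈
  ... | c , c∈ , refl = isArith-tabulate a (unit⇒primitive (unit dec)) , (begin
    sum (tabulate (dOf (decode c)))      ≡⟨ sum-tabulate (dOf (decode c)) ⟩
    ∑ (dOf (decode c))                   ≡⟨ sumFormula a (unit⇒primitive (unit dec)) ⟩
    2 * suc m + ∑ (code (decode c))      ≡⟨ cong (2 * suc m +_) (sum-cong-≗ (code≗ dec)) ⟩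
    2 * suc m + ∑ (lookup c)             ≡⟨ cong (2 * suc m +_) (sum-lookup c) ⟨
    2 * suc m + sum c                    ≡⟨ cong (2 * suc m +_) (∈-compositions⁻ (suc m) j c∈) ⟩
    2 * suc m + j                        ∎)
    where
    open ≡-Reasoning
    dec : IsDecoding (lookup c) (decode c)
    dec = decoding c∈
    a : Arithmetical (decode c)
    a = arithmetical dec

  structure⇒∈ : ∀ {d r} → Structure d r → (d , r) ∈ structures
  structure⇒∈ {d} {r} (isArith , sum≡) with isArith⇒ isArith
  ... | a , prim , d≡ =
    subst (_∈ structures) (cong₂ _,_ d′≡d r′≡r) (∈-map⁺ structureOf (∈-compositions⁺ (suc m) j c ∑c≡j))
    where
    open ≡-Reasoning
    c : Vec ℕ (suc m)
    c = tabulate (code (lookup r))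
    ∑c≡j : sum c ≡ j
    ∑c≡j = +-cancelˡ-≡ (2 * suc m) _ _ (begin
      2 * suc m + sum c                     ≡⟨ cong (2 * suc m +_) (sum-tabulate (code (lookup r))) ⟩
      2 * suc m + ∑ (code (lookup r))       ≡⟨ sumFormula a prim ⟨
      ∑ (dOf (lookup r))                    ≡⟨ sum-tabulate (dOf (lookup r)) ⟨
      sum (tabulate (dOf (lookup r)))       ≡⟨ cong sum d≡ ⟨
      sum d                                 ≡⟨ sum≡ ⟩
      2 * suc m + j                         ∎)
    decoded≗r : decode c ≗ lookup r
    decoded≗r = decode-code a prim
    d′≡d : tabulate (dOf (decode c)) ≡ d
    d′≡d = trans (tabulate-cong (dOf-cong decoded≗r)) (sym d≡)
    r′≡r : tabulate (decode c) ≡ r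
    r′≡r = trans (tabulate-cong decoded≗r) (tabulate∘lookup r)

card-arithmetical-structures : ∀ m j → j < suc m →
  HasCard {suc m} (λ d r → IsArith (suc m) d r × sum d ≡ 2 * suc m + j) ((m + j) C j)
card-arithmetical-structures m j j<n =
  structures , structures-unique , (λ d r → mk⇔ ∈⇒structure structure⇒∈) ,
  trans (length-map structureOf (compositions (suc m) j)) (length-compositions m j)
  where open Counting m j j<n

k∸2n<n : ∀ m k → 2 * suc m ≤ k → k ≤ 3 * suc m ∸ 1 → k ∸ 2 * suc m < suc m
k∸2n<n m k 2n≤k k≤3n-1 = +-cancelˡ-< (2 * n) (k ∸ 2 * n) n (begin-strict
  2 * n + (k ∸ 2 * n)  ≡⟨ m+[n∸m]≡n 2n≤k ⟩
  k                    ≤⟨ k≤3n-1 ⟩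
  3 * n ∸ 1            <⟨ n<1+n (3 * n ∸ 1) ⟩
  3 * n                ≡⟨ split m ⟩
  2 * n + n            ∎)
  where
  open ≤-Reasoning
  n : ℕ
  n = suc m
  split : ∀ m → 3 * suc m ≡ 2 * suc m + suc m
  split = solve-∀

k∸n∸1≡m+[k∸2n] : ∀ m k → 2 * suc m ≤ k → k ∸ suc m ∸ 1 ≡ m + (k ∸ 2 * suc m)
k∸n∸1≡m+[k∸2n] m k 2n≤k = begin
  k ∸ n ∸ 1                        ≡⟨ cong (λ x → x ∸ n ∸ 1) (m+[n∸m]≡n 2n≤k) ⟨
  2 * n + (k ∸ 2 * n) ∸ n ∸ 1      ≡⟨ cong (λ x → x ∸ n ∸ 1) (double n (k ∸ 2 * n)) ⟨
  n + (n + (k ∸ 2 * n)) ∸ n ∸ 1    ≡⟨ cong (_∸ 1) (m+n∸m≡n n (n + (k ∸ 2 * n))) ⟩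
  m + (k ∸ 2 * n)                  ∎
  where
  open ≡-Reasoning
  n : ℕ
  n = suc m
  double : ∀ n j → n + (n + j) ≡ 2 * n + j
  double = solve-∀

corollary3p8 : (n k : ℕ) → 2 ≤ n → 2 * n ≤ k → k ≤ 3 * n ∸ 1 →
    HasCard {n} (λ d r → IsArith n d r × sum d ≡ k) ((k ∸ n ∸ 1) C (k ∸ 2 * n))
corollary3p8 zero    k ()
corollary3p8 (suc m) k _ 2n≤k k≤3n-1 =
  subst₂ (λ x y → HasCard (λ d r → IsArith (suc m) d r × sum d ≡ x) y)
    (m+[n∸m]≡n 2n≤k)
    (cong (_C (k ∸ 2 * suc m)) (sym (k∸n∸1≡m+[k∸2n] m k 2n≤k)))
    (card-arithmetical-structures m (k ∸ 2 * suc m) (k∸2n<n m k 2n≤k k≤3n-1))
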